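{- Let $g_3(n)$ denote the number of independent sets (including the empty set) of the graph $G_3^n$, with the convention $g_3(0)=1$. Then for every integer $n\ge 0$, \[ g_3(n)=\frac{1}{2\sqrt{2}}\left((2+\sqrt{2})^{n+1}-(2-\sqrt{2})^{n+1}\right), \] equivalently $\sum_{n\ge 0} g_3(n)x^n=\dfrac{1}{1-4x+2x^2}$, and $g_3(n)=4g_3(n-1)-2g_3(n-2)$ for $n\ge 2$.
   Context: For integers $\ell\ge 3$ and $n\ge 1$, the graph $G_\ell^n$ is defined as follows. Start with $G_\ell^1=C_\ell$, the cycle on $\ell$ vertices. Given $G_\ell^{n-1}$, whose most recently added vertices form a cycle $C$ of length $\ell$ (for $n-1=1$, the original cycle), obtain $G_\ell^{n}$ by subdividing each edge of $C$ with a new vertex (the new vertex corresponding to that edge, i.e. a vertex of the line graph $L(C)$) and then adding the edges of the line graph $L(C)$ among the new vertices (two new vertices are adjacent iff the corresponding edges of $C$ share an endpoint). Explicitly, $G_\ell^n$ has vertex set $\{(j,i): 1\le j\le n,\ i\in\mathbb{Z}/\ell\mathbb{Z}\}$ ("level" $j$), and its edges are: $(j,i)(j+1,i)$ and $(j,i+1)(j+1,i)$ for $1\le j\le n-1$ and $i\in\mathbb{Z}/\ell\mathbb{Z}$, together with $(n,i)(n,i+1)$ for $i\in\mathbb{Z}/\ell\mathbb{Z}$ (so only the last level $n$ carries cycle edges). $G_\ell^0$ is the empty graph, which has exactly one independent set. -}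

module Defs where

open import Data.Bool using (Bool; true; false)
open import Data.Nat using (ℕ; zero; suc; _+_; _∸_; NonZero)
open import Data.Nat.DivMod using (_mod_)
open import Data.Fin using (Fin; toℕ)
open import Data.Fin.Properties using (all?)
open import Data.Integer as ℤ using (ℤ)
open import Data.List using (List; []; _∷_; map; concatMap; filter; length)
open import Data.Vec using (Vec; []; _∷_; lookup)
open import Data.Product using (_×_; _,_)
open import Data.Sum using (_⊎_)
open import Data.Empty using (⊥)
open import Relation.Nullary using (Dec; ¬_)
open import Relation.Nullary.Decidable using (_×-dec_; _⊎-dec_; _→-dec_; ¬?)
open import Relation.Binary.PropositionalEquality using (_≡_)
import Data.Nat.Properties as ℕP
import Data.Fin.Properties as FinP
import Data.Bool.Properties as BoolP

-- The graph G_ℓ^n.  Vertex (j , i) with j : Fin n the level (0-indexed,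
-- so paper level j+1) and i : Fin ℓ, i.e. i ∈ ℤ/ℓℤ.

sucℓ : ∀ {ℓ} .{{_ : NonZero ℓ}} → Fin ℓ → Fin ℓ
sucℓ {ℓ} i = (suc (toℕ i)) mod ℓ

-- Generating (unordered) edges of G_ℓ^n, written as an ordered relation:
--   (j,i)(j+1,i), (j,i+1)(j+1,i)   for consecutive levels,
--   (n,i)(n,i+1)                   on the last level.
-- Adjacency in G_ℓ^n is the symmetric closure of Edge.
Edge : (n ℓ : ℕ) .{{_ : NonZero ℓ}} → Fin n → Fin ℓ → Fin n → Fin ℓ → Set
Edge n ℓ j i j' i' =
  (toℕ j' ≡ suc (toℕ j) × (i ≡ i' ⊎ i ≡ sucℓ i'))
  ⊎ (suc (toℕ j) ≡ n × toℕ j' ≡ toℕ j × i' ≡ sucℓ i)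

edge? : ∀ n ℓ .{{_ : NonZero ℓ}} j i j' i' → Dec (Edge n ℓ j i j' i')
edge? n ℓ j i j' i' =
  ((toℕ j' ℕP.≟ suc (toℕ j)) ×-dec ((i FinP.≟ i') ⊎-dec (i FinP.≟ sucℓ i')))
  ⊎-dec ((suc (toℕ j) ℕP.≟ n) ×-dec (toℕ j' ℕP.≟ toℕ j) ×-dec (i' FinP.≟ sucℓ i))

VSubset : ℕ → ℕ → Set
VSubset n ℓ = Vec (Vec Bool ℓ) n

_∈ˢ_ : ∀ {n ℓ} → Fin n × Fin ℓ → VSubset n ℓ → Set
(j , i) ∈ˢ S = lookup (lookup S j) i ≡ true

Independent : ∀ n ℓ .{{_ : NonZero ℓ}} → VSubset n ℓ → Set
Independent n ℓ S = ∀ j i j' i' → Edge n ℓ j i j' i' →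
  ¬ ((j , i) ∈ˢ S × (j' , i') ∈ˢ S)

independent? : ∀ n ℓ .{{_ : NonZero ℓ}} (S : VSubset n ℓ) → Dec (Independent n ℓ S)
independent? n ℓ S =
  all? λ j → all? λ i → all? λ j' → all? λ i' →
    edge? n ℓ j i j' i' →-dec
      ¬? ((lookup (lookup S j) i BoolP.≟ true) ×-dec (lookup (lookup S j') i' BoolP.≟ true))

allVecs : {A : Set} → List A → (k : ℕ) → List (Vec A k)
allVecs xs zero = [] ∷ []
allVecs xs (suc k) = concatMap (λ x → map (x ∷_) (allVecs xs k)) xs

allSubsets : ∀ n ℓ → List (VSubset n ℓ)
allSubsets n ℓ = allVecs (allVecs (false ∷ true ∷ []) ℓ) n

-- number of independent sets (including ∅) of G_ℓ^n; for n = 0 the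
-- vertex set is empty and this is 1.
numIndep : ∀ n ℓ .{{_ : NonZero ℓ}} → ℕ
numIndep n ℓ = length (filter (independent? n ℓ) (allSubsets n ℓ))

g₃ : ℕ → ℕ
g₃ n = numIndep n 3

-- The ring ℤ[√2]: a + b√2 represented as (a , b).

record ℤ√2 : Set where
  constructor mk√
  field
    re : ℤ
    im : ℤ

open ℤ√2 public

infixl 6 _⊕_ _⊖_
infixl 7 _⊗_

_⊕_ : ℤ√2 → ℤ√2 → ℤ√2
mk√ (a) (b) ⊕ mk√ (c) (d) = mk√ (a ℤ.+ c) (b ℤ.+ d)

_⊖_ : ℤ√2 → ℤ√2 → ℤ√2
mk√ (a) (b) ⊖ mk√ (c) (d) = mk√ (a ℤ.- c) (b ℤ.- d)

_⊗_ : ℤ√2 → ℤ√2 → ℤ√2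
mk√ (a) (b) ⊗ mk√ (c) (d) = mk√ (a ℤ.* c ℤ.+ ℤ.+ 2 ℤ.* b ℤ.* d) (a ℤ.* d ℤ.+ b ℤ.* c)

_^√_ : ℤ√2 → ℕ → ℤ√2
x ^√ zero = mk√ (ℤ.+ 1) (ℤ.+ 0)
x ^√ suc k = x ⊗ (x ^√ k)

ι : ℕ → ℤ√2
ι m = mk√ (ℤ.+ m) (ℤ.+ 0)

-- Deleting the first level of G_ℓ^(n+2) leaves a copy of G_ℓ^(n+1), and the first two levels
-- interact only through the edges (1,i)(2,i) and (1,i+1)(2,i). So the number of independent sets
-- with a prescribed first level obeys a transfer recursion over the next level. For ℓ = 3 that
-- number only depends on whether the first level is empty, one vertex, or larger; the resulting
-- 3×3 system has the invariant a = b + 2d, which collapses it to g(n+2) = 4 g(n+1) − 2 g(n).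
-- Since 2 + √2 is a root of x² − 4x + 2, the √2-coordinate of (2+√2)^(n+1) obeys the same
-- recurrence with the same initial values 1, 4, and subtracting the conjugate power doubles it.
module Submission where

open import Defs
open import Data.Nat using (ℕ; suc; _+_; _*_)
open import Data.Integer using (+_; -_)
open import Data.Product using (_×_)
open import Relation.Binary.PropositionalEquality using (_≡_)

open import Algebra.Bundles using (AbelianGroup)
open import Data.Bool as Bool using (Bool; true; false)
import Data.Fin as Fin
import Data.Fin.Properties as Fin
open import Data.Integer as ℤ using (ℤ)
import Data.Integer.Properties as ℤ
import Data.Integer.Tactic.RingSolver as ℤ-Solver
open import Data.List using (List; []; _∷_; map; concatMap; filter; length; _++_)
open import Data.List.Properties using (length-++; filter-++; filter-≐; filter-none; map-cong)
open import Data.List.Relation.Unary.All using (universal)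
open import Data.Nat using (zero; NonZero)
open import Data.Nat.ListAction using (sum)
open import Data.Nat.Properties using (+-identityʳ; suc-injective)
open import Data.Nat.Tactic.RingSolver using (solve-∀)
open import Data.Product using (_,_; proj₁; proj₂)
open import Data.Sum using (_⊎_; inj₁; inj₂)
open import Data.Vec using (Vec; []; _∷_; lookup)
open import Function using (_∘_)
open import Relation.Binary.PropositionalEquality using (refl; trans; cong; cong₂; module ≡-Reasoning)
open import Relation.Nullary using (Dec; yes; no; ¬_)
open import Relation.Nullary.Decidable using (_×-dec_; _⊎-dec_; _→-dec_; ¬?)
open import Relation.Unary using (Decidable)

open import Algebra.Properties.Group (AbelianGroup.group ℤ.+-0-abelianGroup)
  using () renaming (∙-cancelʳ to +-cancelʳ)

length-filter-map : {A B : Set} {P : B → Set} (P? : Decidable P) (f : A → B) (xs : List A) →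
  length (filter P? (map f xs)) ≡ length (filter (P? ∘ f) xs)
length-filter-map P? f [] = refl
length-filter-map P? f (x ∷ xs) with P? (f x)
... | yes _ = cong suc (length-filter-map P? f xs)
... | no _ = length-filter-map P? f xs

length-filter-concatMap-∷ : {A : Set} {k : ℕ} {P : Vec A (suc k) → Set} (P? : Decidable P)
  (vs : List (Vec A k)) (xs : List A) →
  length (filter P? (concatMap (λ x → map (x ∷_) vs) xs))
    ≡ sum (map (λ x → length (filter (P? ∘ (x ∷_)) vs)) xs)
length-filter-concatMap-∷ P? vs [] = refl
length-filter-concatMap-∷ {A} {k} P? vs (x ∷ xs) = begin
  length (filter P? (map (x ∷_) vs ++ rest))
    ≡⟨ cong length (filter-++ P? (map (x ∷_) vs) rest) ⟩
  length (filter P? (map (x ∷_) vs) ++ filter P? rest)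
    ≡⟨ length-++ (filter P? (map (x ∷_) vs)) ⟩
  length (filter P? (map (x ∷_) vs)) + length (filter P? rest)
    ≡⟨ cong₂ _+_ (length-filter-map P? (x ∷_) vs) (length-filter-concatMap-∷ P? vs xs) ⟩
  sum (map (λ y → length (filter (P? ∘ (y ∷_)) vs)) (x ∷ xs)) ∎
  where
  open ≡-Reasoning
  rest : List (Vec A (suc k))
  rest = concatMap (λ y → map (y ∷_) vs) xs

sum-map-filter : {A : Set} {P : A → Set} (P? : Decidable P) {f g : A → ℕ} →
  (∀ x → P x → f x ≡ g x) → (∀ x → ¬ P x → f x ≡ 0) →
  ∀ xs → sum (map f xs) ≡ sum (map g (filter P? xs))
sum-map-filter P? on off [] = refl
sum-map-filter P? on off (x ∷ xs) with P? x
... | yes px = cong₂ _+_ (on x px) (sum-map-filter P? on off xs)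
... | no ¬px = cong₂ _+_ (off x ¬px) (sum-map-filter P? on off xs)

rows : (ℓ : ℕ) → List (Vec Bool ℓ)
rows = allVecs (false ∷ true ∷ [])

module Levels {ℓ : ℕ} .{{_ : NonZero ℓ}} where

  -- T is the row of some level j and U that of level j + 1.
  Compatible : Vec Bool ℓ → Vec Bool ℓ → Set
  Compatible T U = ∀ i i' → i ≡ i' ⊎ i ≡ sucℓ i' → ¬ (lookup T i ≡ true × lookup U i' ≡ true)

  compatible? : ∀ T U → Dec (Compatible T U)
  compatible? T U = Fin.all? λ i → Fin.all? λ i' →
    ((i Fin.≟ i') ⊎-dec (i Fin.≟ sucℓ i')) →-dec
      ¬? ((lookup T i Bool.≟ true) ×-dec (lookup U i' Bool.≟ true))

  Edge-suc⁺ : ∀ {n j i j' i'} → Edge (suc n) ℓ j i j' i' →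
    Edge (suc (suc n)) ℓ (Fin.suc j) i (Fin.suc j') i'
  Edge-suc⁺ (inj₁ (e , x)) = inj₁ (cong suc e , x)
  Edge-suc⁺ (inj₂ (e₁ , e₂ , e₃)) = inj₂ (cong suc e₁ , cong suc e₂ , e₃)

  Edge-suc⁻ : ∀ {n j i j' i'} → Edge (suc (suc n)) ℓ (Fin.suc j) i (Fin.suc j') i' →
    Edge (suc n) ℓ j i j' i'
  Edge-suc⁻ (inj₁ (e , x)) = inj₁ (suc-injective e , x)
  Edge-suc⁻ (inj₂ (e₁ , e₂ , e₃)) = inj₂ (suc-injective e₁ , suc-injective e₂ , e₃)

  independent-∷∷⁻ : ∀ {n} T U (R : VSubset n ℓ) → Independent (suc (suc n)) ℓ (T ∷ U ∷ R) →
    Compatible T U × Independent (suc n) ℓ (U ∷ R)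
  independent-∷∷⁻ T U R I =
    (λ i i' e → I Fin.zero i (Fin.suc Fin.zero) i' (inj₁ (refl , e))) ,
    (λ j i j' i' E → I (Fin.suc j) i (Fin.suc j') i' (Edge-suc⁺ E))

  independent-∷∷⁺ : ∀ {n} T U (R : VSubset n ℓ) → Compatible T U →
    Independent (suc n) ℓ (U ∷ R) → Independent (suc (suc n)) ℓ (T ∷ U ∷ R)
  independent-∷∷⁺ T U R c I Fin.zero i Fin.zero i' (inj₁ (() , _))
  independent-∷∷⁺ T U R c I Fin.zero i Fin.zero i' (inj₂ (() , _))
  independent-∷∷⁺ T U R c I Fin.zero i (Fin.suc Fin.zero) i' (inj₁ (_ , x)) = c i i' x
  independent-∷∷⁺ T U R c I Fin.zero i (Fin.suc Fin.zero) i' (inj₂ (() , _))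
  independent-∷∷⁺ T U R c I Fin.zero i (Fin.suc (Fin.suc j')) i' (inj₁ (() , _))
  independent-∷∷⁺ T U R c I Fin.zero i (Fin.suc (Fin.suc j')) i' (inj₂ (() , _))
  independent-∷∷⁺ T U R c I (Fin.suc j) i Fin.zero i' (inj₁ (() , _))
  independent-∷∷⁺ T U R c I (Fin.suc j) i Fin.zero i' (inj₂ (_ , () , _))
  independent-∷∷⁺ T U R c I (Fin.suc j) i (Fin.suc j') i' E = I j i j' i' (Edge-suc⁻ E)

  numIndepWithFirstLevel : ℕ → Vec Bool ℓ → ℕ
  numIndepWithFirstLevel n U =
    length (filter (λ R → independent? (suc n) ℓ (U ∷ R)) (allVecs (rows ℓ) n))

  numIndep-suc : ∀ n → numIndep (suc n) ℓ ≡ sum (map (numIndepWithFirstLevel n) (rows ℓ))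
  numIndep-suc n =
    length-filter-concatMap-∷ (independent? (suc n) ℓ) (allVecs (rows ℓ) n) (rows ℓ)

  numIndepWithFirstLevel-suc : ∀ n U → numIndepWithFirstLevel (suc n) U
    ≡ sum (map (numIndepWithFirstLevel n) (filter (compatible? U) (rows ℓ)))
  numIndepWithFirstLevel-suc n U = begin
    numIndepWithFirstLevel (suc n) U
      ≡⟨ length-filter-concatMap-∷ (λ R → independent? (suc (suc n)) ℓ (U ∷ R)) subsets (rows ℓ) ⟩
    sum (map extensions (rows ℓ))
      ≡⟨ sum-map-filter (compatible? U) compatible incompatible (rows ℓ) ⟩
    sum (map (numIndepWithFirstLevel n) (filter (compatible? U) (rows ℓ))) ∎
    where
    open ≡-Reasoning
    subsets : List (VSubset n ℓ)
    subsets = allVecs (rows ℓ) n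

    extensions : Vec Bool ℓ → ℕ
    extensions V = length (filter (λ R → independent? (suc (suc n)) ℓ (U ∷ V ∷ R)) subsets)

    compatible : ∀ V → Compatible U V → extensions V ≡ numIndepWithFirstLevel n V
    compatible V c = cong length (filter-≐ _ _
      ((λ {R} → proj₂ ∘ independent-∷∷⁻ U V R) , (λ {R} → independent-∷∷⁺ U V R c)) subsets)

    incompatible : ∀ V → ¬ Compatible U V → extensions V ≡ 0
    incompatible V ¬c = cong length (filter-none _
      (universal (λ R → ¬c ∘ proj₁ ∘ independent-∷∷⁻ U V R) subsets))

open Levels

-- For ℓ = 3 the level below an empty row is unconstrained, the level below a single vertex i is
-- ∅ or {i+1}, and the level below two or more vertices is ∅; a lone last level must avoid the
-- triangle edges.
countEmpty countSingle countCrowded : ℕ → ℕ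
countEmpty zero = 1
countEmpty (suc n) = countEmpty n + 3 * countSingle n + 4 * countCrowded n
countSingle zero = 1
countSingle (suc n) = countEmpty n + countSingle n
countCrowded zero = 0
countCrowded (suc n) = countEmpty n

countByShape : ℕ → Vec Bool 3 → ℕ
countByShape n (false ∷ false ∷ false ∷ []) = countEmpty n
countByShape n (true ∷ false ∷ false ∷ []) = countSingle n
countByShape n (false ∷ true ∷ false ∷ []) = countSingle n
countByShape n (false ∷ false ∷ true ∷ []) = countSingle n
countByShape n _ = countCrowded n

countByShape-suc : ∀ n U →
  sum (map (countByShape n) (filter (compatible? U) (rows 3))) ≡ countByShape (suc n) U
countByShape-suc n (false ∷ false ∷ false ∷ []) =
  allRows (countEmpty n) (countSingle n) (countCrowded n)
  where
  allRows : ∀ a b d → a + (b + (b + (d + (b + (d + (d + (d + 0))))))) ≡ a + 3 * b + 4 * d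
  allRows = solve-∀
countByShape-suc n (false ∷ false ∷ true ∷ []) = cong (_+_ (countEmpty n)) (+-identityʳ _)
countByShape-suc n (false ∷ true ∷ false ∷ []) = cong (_+_ (countEmpty n)) (+-identityʳ _)
countByShape-suc n (true ∷ false ∷ false ∷ []) = cong (_+_ (countEmpty n)) (+-identityʳ _)
countByShape-suc n (false ∷ true ∷ true ∷ []) = +-identityʳ _
countByShape-suc n (true ∷ false ∷ true ∷ []) = +-identityʳ _
countByShape-suc n (true ∷ true ∷ false ∷ []) = +-identityʳ _
countByShape-suc n (true ∷ true ∷ true ∷ []) = +-identityʳ _

numIndepWithFirstLevel≡countByShape : ∀ n U → numIndepWithFirstLevel n U ≡ countByShape n U
numIndepWithFirstLevel≡countByShape zero (false ∷ false ∷ false ∷ []) = refl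
numIndepWithFirstLevel≡countByShape zero (false ∷ false ∷ true ∷ []) = refl
numIndepWithFirstLevel≡countByShape zero (false ∷ true ∷ false ∷ []) = refl
numIndepWithFirstLevel≡countByShape zero (false ∷ true ∷ true ∷ []) = refl
numIndepWithFirstLevel≡countByShape zero (true ∷ false ∷ false ∷ []) = refl
numIndepWithFirstLevel≡countByShape zero (true ∷ false ∷ true ∷ []) = refl
numIndepWithFirstLevel≡countByShape zero (true ∷ true ∷ false ∷ []) = refl
numIndepWithFirstLevel≡countByShape zero (true ∷ true ∷ true ∷ []) = refl
numIndepWithFirstLevel≡countByShape (suc n) U = begin
  numIndepWithFirstLevel (suc n) U
    ≡⟨ numIndepWithFirstLevel-suc n U ⟩
  sum (map (numIndepWithFirstLevel n) below)
    ≡⟨ cong sum (map-cong (numIndepWithFirstLevel≡countByShape n) below) ⟩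
  sum (map (countByShape n) below)
    ≡⟨ countByShape-suc n U ⟩
  countByShape (suc n) U ∎
  where
  open ≡-Reasoning
  below : List (Vec Bool 3)
  below = filter (compatible? U) (rows 3)

empty : Vec Bool 3
empty = false ∷ false ∷ false ∷ []

filter-compatible-empty : filter (compatible? empty) (rows 3) ≡ rows 3
filter-compatible-empty = refl

g₃≡countEmpty : ∀ n → g₃ n ≡ countEmpty n
g₃≡countEmpty zero = refl
g₃≡countEmpty (suc n) = begin
  g₃ (suc n)
    ≡⟨ numIndep-suc {3} n ⟩
  sum (map (numIndepWithFirstLevel n) (rows 3))
    ≡⟨ cong (sum ∘ map (numIndepWithFirstLevel n)) filter-compatible-empty ⟨
  sum (map (numIndepWithFirstLevel n) (filter (compatible? empty) (rows 3)))
    ≡⟨ numIndepWithFirstLevel-suc n empty ⟨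
  numIndepWithFirstLevel (suc n) empty
    ≡⟨ numIndepWithFirstLevel≡countByShape (suc n) empty ⟩
  countEmpty (suc n) ∎
  where open ≡-Reasoning

countEmpty≡countSingle+2*countCrowded : ∀ n → countEmpty n ≡ countSingle n + 2 * countCrowded n
countEmpty≡countSingle+2*countCrowded zero = refl
countEmpty≡countSingle+2*countCrowded (suc n) rewrite countEmpty≡countSingle+2*countCrowded n =
  identity (countSingle n) (countCrowded n)
  where
  identity : ∀ b d → (b + 2 * d) + 3 * b + 4 * d ≡ ((b + 2 * d) + b) + 2 * (b + 2 * d)
  identity = solve-∀

countEmpty-rec : ∀ n → countEmpty (suc (suc n)) + 2 * countEmpty n ≡ 4 * countEmpty (suc n)
countEmpty-rec n rewrite countEmpty≡countSingle+2*countCrowded n =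
  identity (countSingle n) (countCrowded n)
  where
  identity : ∀ b d → let a = b + 2 * d in
    (a + 3 * b + 4 * d) + 3 * (a + b) + 4 * a + 2 * a ≡ 4 * (a + 3 * b + 4 * d)
  identity = solve-∀

g₃-rec : ∀ n → g₃ (suc (suc n)) + 2 * g₃ n ≡ 4 * g₃ (suc n)
g₃-rec n = begin
  g₃ (suc (suc n)) + 2 * g₃ n
    ≡⟨ cong₂ (λ x y → x + 2 * y) (g₃≡countEmpty (suc (suc n))) (g₃≡countEmpty n) ⟩
  countEmpty (suc (suc n)) + 2 * countEmpty n   ≡⟨ countEmpty-rec n ⟩
  4 * countEmpty (suc n)                        ≡⟨ cong (4 *_) (g₃≡countEmpty (suc n)) ⟨
  4 * g₃ (suc n)                                ∎
  where open ≡-Reasoning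

LinearRecurrence : ℤ → ℤ → (ℕ → ℤ) → Set
LinearRecurrence c d f = ∀ n → f (suc (suc n)) ℤ.+ c ℤ.* f n ≡ d ℤ.* f (suc n)

LinearRecurrence-pos : ∀ c d (f : ℕ → ℕ) → (∀ n → f (suc (suc n)) + c * f n ≡ d * f (suc n)) →
  LinearRecurrence (+ c) (+ d) (+_ ∘ f)
LinearRecurrence-pos c d f rec n = begin
  + f (suc (suc n)) ℤ.+ + c ℤ.* + f n   ≡⟨ cong (ℤ._+_ (+ f (suc (suc n)))) (ℤ.pos-* c (f n)) ⟨
  + f (suc (suc n)) ℤ.+ + (c * f n)     ≡⟨ ℤ.pos-+ (f (suc (suc n))) (c * f n) ⟨
  + (f (suc (suc n)) + c * f n)         ≡⟨ cong +_ (rec n) ⟩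
  + (d * f (suc n))                     ≡⟨ ℤ.pos-* d (f (suc n)) ⟩
  + d ℤ.* + f (suc n)                   ∎
  where open ≡-Reasoning

LinearRecurrence-unique : ∀ c d {f h : ℕ → ℤ} → LinearRecurrence c d f → LinearRecurrence c d h →
  f 0 ≡ h 0 → f 1 ≡ h 1 → ∀ n → f n ≡ h n
LinearRecurrence-unique c d {f} {h} f-rec h-rec f₀ f₁ n = proj₁ (agree n)
  where
  open ≡-Reasoning
  agree : ∀ n → f n ≡ h n × f (suc n) ≡ h (suc n)
  agree zero = f₀ , f₁
  agree (suc n) = fₙ₊₁ , +-cancelʳ (c ℤ.* f n) (f (suc (suc n))) (h (suc (suc n))) (begin
    f (suc (suc n)) ℤ.+ c ℤ.* f n   ≡⟨ f-rec n ⟩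
    d ℤ.* f (suc n)                 ≡⟨ cong (d ℤ.*_) fₙ₊₁ ⟩
    d ℤ.* h (suc n)                 ≡⟨ h-rec n ⟨
    h (suc (suc n)) ℤ.+ c ℤ.* h n   ≡⟨ cong (λ x → h (suc (suc n)) ℤ.+ c ℤ.* x) fₙ ⟨
    h (suc (suc n)) ℤ.+ c ℤ.* f n   ∎)
    where
    fₙ : f n ≡ h n
    fₙ = proj₁ (agree n)
    fₙ₊₁ : f (suc n) ≡ h (suc n)
    fₙ₊₁ = proj₂ (agree n)

conj : ℤ√2 → ℤ√2
conj (mk√ a b) = mk√ a (ℤ.- b)

conj-⊗ : ∀ x y → conj (x ⊗ y) ≡ conj x ⊗ conj y
conj-⊗ (mk√ a b) (mk√ c d) = cong₂ mk√ (re-identity a b c d) (im-identity a b c d)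
  where
  re-identity : ∀ a b c d → a ℤ.* c ℤ.+ + 2 ℤ.* b ℤ.* d ≡ a ℤ.* c ℤ.+ + 2 ℤ.* (ℤ.- b) ℤ.* (ℤ.- d)
  re-identity = ℤ-Solver.solve-∀
  im-identity : ∀ a b c d → ℤ.- (a ℤ.* d ℤ.+ b ℤ.* c) ≡ a ℤ.* (ℤ.- d) ℤ.+ (ℤ.- b) ℤ.* c
  im-identity = ℤ-Solver.solve-∀

conj-^√ : ∀ x k → conj (x ^√ k) ≡ conj x ^√ k
conj-^√ x zero = refl
conj-^√ x (suc k) = trans (conj-⊗ x (x ^√ k)) (cong (conj x ⊗_) (conj-^√ x k))

⊖-conj : ∀ x → x ⊖ conj x ≡ mk√ (+ 0) (+ 2 ℤ.* im x)
⊖-conj (mk√ a b) = cong₂ mk√ (ℤ.+-inverseʳ a) (identity b)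
  where
  identity : ∀ b → b ℤ.- (ℤ.- b) ≡ + 2 ℤ.* b
  identity = ℤ-Solver.solve-∀

mk√0-⊗-ι : ∀ b m → mk√ (+ 0) b ⊗ ι m ≡ mk√ (+ 0) (b ℤ.* + m)
mk√0-⊗-ι b m = cong₂ mk√ (re-identity b (+ m)) (im-identity b (+ m))
  where
  re-identity : ∀ b c → + 0 ℤ.* c ℤ.+ + 2 ℤ.* b ℤ.* + 0 ≡ + 0
  re-identity = ℤ-Solver.solve-∀
  im-identity : ∀ b c → + 0 ℤ.* + 0 ℤ.+ b ℤ.* c ≡ b ℤ.* c
  im-identity = ℤ-Solver.solve-∀

α : ℤ√2
α = mk√ (+ 2) (+ 1)

im-α^-rec : LinearRecurrence (+ 2) (+ 4) (λ k → im (α ^√ k))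
im-α^-rec k = α²≡4α-2 (re (α ^√ k)) (im (α ^√ k))
  where
  -- the √2-coordinates of α ⊗ (α ⊗ mk√ a b), of mk√ a b and of α ⊗ mk√ a b
  α²≡4α-2 : ∀ a b →
    (+ 2 ℤ.* (+ 2 ℤ.* b ℤ.+ + 1 ℤ.* a) ℤ.+ + 1 ℤ.* (+ 2 ℤ.* a ℤ.+ + 2 ℤ.* + 1 ℤ.* b)) ℤ.+ + 2 ℤ.* b
      ≡ + 4 ℤ.* (+ 2 ℤ.* b ℤ.+ + 1 ℤ.* a)
  α²≡4α-2 = ℤ-Solver.solve-∀

g₃≡im-α^ : ∀ n → + g₃ n ≡ im (α ^√ suc n)
g₃≡im-α^ = LinearRecurrence-unique (+ 2) (+ 4)
  (LinearRecurrence-pos 2 4 g₃ g₃-rec) (im-α^-rec ∘ suc) refl refl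

mainTheorem1 : (n : ℕ) →
    (mk√ (+ 0) (+ 2) ⊗ ι (g₃ n)
      ≡ (mk√ (+ 2) (+ 1) ^√ suc n) ⊖ (mk√ (+ 2) (- (+ 1)) ^√ suc n))
    × (g₃ (suc (suc n)) + 2 * g₃ n ≡ 4 * g₃ (suc n))
mainTheorem1 n = closedForm , g₃-rec n
  where
  open ≡-Reasoning
  closedForm : mk√ (+ 0) (+ 2) ⊗ ι (g₃ n) ≡ (α ^√ suc n) ⊖ (conj α ^√ suc n)
  closedForm = begin
    mk√ (+ 0) (+ 2) ⊗ ι (g₃ n)         ≡⟨ mk√0-⊗-ι (+ 2) (g₃ n) ⟩
    mk√ (+ 0) (+ 2 ℤ.* + g₃ n)         ≡⟨ cong (mk√ (+ 0) ∘ ℤ._*_ (+ 2)) (g₃≡im-α^ n) ⟩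
    mk√ (+ 0) (+ 2 ℤ.* im (α ^√ suc n)) ≡⟨ ⊖-conj (α ^√ suc n) ⟨
    α ^√ suc n ⊖ conj (α ^√ suc n)     ≡⟨ cong (α ^√ suc n ⊖_) (conj-^√ α (suc n)) ⟩
    α ^√ suc n ⊖ conj α ^√ suc n       ∎
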